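{- Let $n\ge 3$ and let $\epsilon=(\epsilon_i^r)_{i,r=1}^n$ be an $n\times n$ complex matrix all of whose row sums and column sums are zero. Then \[ \sum_{\substack{i\neq j\\ r\neq s}} \epsilon_i^r\epsilon_j^s = \operatorname{tr}(\epsilon^{\top}\epsilon)=\sum_{i,r}(\epsilon_i^r)^2, \qquad \sum_{\substack{i,j,k \text{ distinct}\\ r,s,t \text{ distinct}}} \epsilon_i^r\epsilon_j^s\epsilon_k^t = 4\sum_{i,r}(\epsilon_i^r)^3, \] where the first sum is over ordered pairs of distinct row indices $(i,j)$ and ordered pairs of distinct column indices $(r,s)$, and the second over ordered triples of distinct row indices $(i,j,k)$ and ordered triples of distinct column indices $(r,s,t)$, all indices ranging over $\{1,\dots,n\}$.
   Context: $\epsilon_i^r$ denotes the entry of $\epsilon$ in row $i$ and column $r$. -}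

module Defs where

open import Level using (Level)
open import Data.Nat using (ℕ; zero; suc)
open import Data.Fin using (Fin; zero; suc; _≟_)
open import Data.Bool using (if_then_else_)
open import Relation.Nullary using (does)
open import Algebra.Bundles using (CommutativeRing)

-- Finite sums and the sums occurring in the theorem, over an arbitrary
-- commutative ring R (the paper's case is R = ℂ).
module Sums {c ℓ : Level} (R : CommutativeRing c ℓ) where
  open CommutativeRing R hiding (zero)

  Σ : {n : ℕ} → (Fin n → Carrier) → Carrier
  Σ {zero}  f = 0#
  Σ {suc n} f = f zero + Σ (λ i → f (suc i))

  when≢ : {n : ℕ} → Fin n → Fin n → Carrier → Carrier
  when≢ i j x = if does (i ≟ j) then 0# else x

  distinct3 : {n : ℕ} → Fin n → Fin n → Fin n → Carrier → Carrier
  distinct3 i j k x = when≢ i j (when≢ i k (when≢ j k x))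

  Matrix : ℕ → Set c
  Matrix n = Fin n → Fin n → Carrier   -- ε i r = ε_i^r (row i, column r)

  rowSumsZero : {n : ℕ} → Matrix n → Set ℓ
  rowSumsZero ε = ∀ i → Σ (λ r → ε i r) ≈ 0#

  colSumsZero : {n : ℕ} → Matrix n → Set ℓ
  colSumsZero ε = ∀ r → Σ (λ i → ε i r) ≈ 0#

  pairSum : {n : ℕ} → Matrix n → Carrier
  pairSum ε = Σ λ i → Σ λ j → Σ λ r → Σ λ s →
    when≢ i j (when≢ r s (ε i r * ε j s))

  tripleSum : {n : ℕ} → Matrix n → Carrier
  tripleSum ε = Σ λ i → Σ λ j → Σ λ k → Σ λ r → Σ λ s → Σ λ t →
    distinct3 i j k (distinct3 r s t (ε i r * ε j s * ε k t))

  transpose : {n : ℕ} → Matrix n → Matrix n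
  transpose ε i r = ε r i

  _·_ : {n : ℕ} → Matrix n → Matrix n → Matrix n
  (A · B) i r = Σ λ k → A i k * B k r

  tr : {n : ℕ} → Matrix n → Carrier
  tr A = Σ λ i → A i i

  sumSq : {n : ℕ} → Matrix n → Carrier
  sumSq ε = Σ λ i → Σ λ r → ε i r * ε i r

  sumCube : {n : ℕ} → Matrix n → Carrier
  sumCube ε = Σ λ i → Σ λ r → ε i r * ε i r * ε i r

  four : Carrier
  four = 1# + 1# + 1# + 1#

  open CommutativeRing R public using (_≈_; _*_)

-- For vectors a, b with Σ a · Σ b = 0, the sum of a_r b_s over r ≠ s is the full
-- sum minus its diagonal, −Σ_r a_r b_r.  For zero-sum vectors a, b, c, removing the
-- terms t = r and t = s from Σ_t c_t = 0 turns the sum of a_r b_s c_t over distinct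
-- r, s, t into two such pair sums, which gives 2 Σ_r a_r b_r c_r.  The guards i ≠ j
-- are additive in the summand, so both sums of the theorem can be evaluated first
-- along the rows of ε, for fixed row indices, and then, after exchanging the order
-- of summation, along its columns: the signs (−1)(−1) give the trace identity and
-- the factors 2 · 2 the factor 4.
module Submission where

open import Defs
open import Level using (Level)
open import Data.Nat using (ℕ; _≤_)
open import Data.Product using (_×_; _,_)
open import Algebra.Bundles using (CommutativeRing)
open import Data.Fin using (Fin; zero; suc; _≟_)
open import Relation.Nullary using (yes; no)
open import Data.Empty using (⊥-elim)
open import Relation.Binary.PropositionalEquality using (_≢_; ≢-sym)
open import Algebra.Morphism.Structures using (IsMonoidHomomorphism)
import Algebra.Morphism.Construct.Composition as Composition

module DistinctIndexSums {c ℓ : Level} (R : CommutativeRing c ℓ) where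
  open CommutativeRing R hiding (zero)
  open Sums R hiding (_≈_; _*_)
  open import Algebra.Properties.Ring ring using (-0#≈0#; -‿involutive; -‿+-comm)
  open import Algebra.Properties.AbelianGroup +-abelianGroup using (xyx⁻¹≈y)
  open import Algebra.Properties.CommutativeSemigroup +-commutativeSemigroup
    using (interchange)
  open import Algebra.Properties.CommutativeSemigroup *-commutativeSemigroup
    using (xy∙z≈xz∙y)
  open import Relation.Binary.Reasoning.Setoid setoid

  -- Σ is not definitionally the library's sum when the length is a variable, so its
  -- laws are proved directly.  Since Σ {n} is not injective in n, the length must
  -- often be passed explicitly when the summand is left to unification.
  Σ-cong : ∀ {n} {f g : Fin n → Carrier} → (∀ i → f i ≈ g i) → Σ f ≈ Σ g
  Σ-cong {ℕ.zero}  f≈g = refl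
  Σ-cong {ℕ.suc n} f≈g = +-cong (f≈g zero) (Σ-cong (λ i → f≈g (suc i)))

  Σ-zero : ∀ n → Σ {n} (λ _ → 0#) ≈ 0#
  Σ-zero ℕ.zero    = refl
  Σ-zero (ℕ.suc n) = trans (+-identityˡ _) (Σ-zero n)

  Σ-distrib-+ : ∀ {n} (f g : Fin n → Carrier) → Σ (λ i → f i + g i) ≈ Σ f + Σ g
  Σ-distrib-+ {ℕ.zero}  f g = sym (+-identityˡ 0#)
  Σ-distrib-+ {ℕ.suc n} f g =
    trans (+-congˡ (Σ-distrib-+ (λ i → f (suc i)) (λ i → g (suc i))))
          (interchange _ _ _ _)

  Σ-comm : ∀ {m n} (f : Fin m → Fin n → Carrier) →
    Σ (λ i → Σ (λ j → f i j)) ≈ Σ (λ j → Σ (λ i → f i j))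
  Σ-comm {ℕ.zero}  {n} f = sym (Σ-zero n)
  Σ-comm {ℕ.suc m} f =
    trans (+-congˡ (Σ-comm (λ i → f (suc i))))
          (sym (Σ-distrib-+ (f zero) (λ j → Σ (λ i → f (suc i) j))))

  Σ-delete : ∀ {n} (r : Fin n) (g : Fin n → Carrier) →
    Σ (λ s → when≢ r s (g s)) ≈ Σ g - g r
  Σ-delete zero    g = trans (+-identityˡ _) (sym (xyx⁻¹≈y (g zero) _))
  Σ-delete (suc r) g =
    trans (+-congˡ (Σ-delete r (λ s → g (suc s)))) (sym (+-assoc _ _ _))

  Additive : (Carrier → Carrier) → Set (c Level.⊔ ℓ)
  Additive = IsMonoidHomomorphism +-rawMonoid +-rawMonoid

  module Additive = IsMonoidHomomorphism

  additive : {φ : Carrier → Carrier} → (∀ {x y} → x ≈ y → φ x ≈ φ y) →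
    (∀ x y → φ (x + y) ≈ φ x + φ y) → φ 0# ≈ 0# → Additive φ
  additive φ-cong φ-+ φ-0 = record
    { isMagmaHomomorphism = record
      { isRelHomomorphism = record { cong = φ-cong }
      ; homo              = φ-+
      }
    ; ε-homo              = φ-0
    }

  -‿additive : Additive (-_)
  -‿additive = additive -‿cong (λ x y → sym (-‿+-comm x y)) -0#≈0#

  *-additiveˡ : ∀ x → Additive (x *_)
  *-additiveˡ x = additive *-congˡ (distribˡ x) (zeroʳ x)

  *-additiveʳ : ∀ x → Additive (_* x)
  *-additiveʳ x = additive *-congʳ (distribʳ x) (zeroˡ x)

  Σ-additive : ∀ {n} {φ : Carrier → Carrier} → Additive φ →
    (f : Fin n → Carrier) →
    Σ (λ i → φ (f i)) ≈ φ (Σ f)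
  Σ-additive {ℕ.zero}  φ f = sym (Additive.ε-homo φ)
  Σ-additive {ℕ.suc n} φ f =
    trans (+-congˡ (Σ-additive φ (λ i → f (suc i))))
          (sym (Additive.homo φ (f zero) _))

  when≢-cong-≢ : ∀ {m} (i j : Fin m) {x y} → (i ≢ j → x ≈ y) →
    when≢ i j x ≈ when≢ i j y
  when≢-cong-≢ i j i≢j⇒x≈y with i ≟ j
  ... | yes _   = refl
  ... | no  i≢j = i≢j⇒x≈y i≢j

  when≢-≢ : ∀ {m} {i j : Fin m} {x} → i ≢ j → when≢ i j x ≈ x
  when≢-≢ {i = i} {j} i≢j with i ≟ j
  ... | yes i≡j = ⊥-elim (i≢j i≡j)
  ... | no  _   = refl

  when≢-neg : ∀ {m} (i j : Fin m) x → when≢ i j (- x) ≈ - when≢ i j x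
  when≢-neg i j x with i ≟ j
  ... | yes _ = sym -0#≈0#
  ... | no  _ = refl

  when≢-additive : ∀ {m} (i j : Fin m) → Additive (when≢ i j)
  when≢-additive i j =
    additive (λ x≈y → when≢-cong-≢ i j (λ _ → x≈y)) +-homo 0-homo
    where
    +-homo : ∀ x y → when≢ i j (x + y) ≈ when≢ i j x + when≢ i j y
    +-homo x y with i ≟ j
    ... | yes _ = sym (+-identityˡ 0#)
    ... | no  _ = refl
    0-homo : when≢ i j 0# ≈ 0#
    0-homo with i ≟ j
    ... | yes _ = refl
    ... | no  _ = refl

  distinct3-additive : ∀ {m} (i j k : Fin m) → Additive (distinct3 i j k)
  distinct3-additive i j k =
    compose (when≢-additive j k) (compose (when≢-additive i k) (when≢-additive i j))
    where compose = Composition.isMonoidHomomorphism trans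

  Σ-delete₂ : ∀ {n} {r s : Fin n} → r ≢ s → (g : Fin n → Carrier) →
    Σ (λ t → when≢ r t (when≢ s t (g t))) ≈ Σ g - g s - g r
  Σ-delete₂ {r = r} {s} r≢s g = begin
    Σ (λ t → when≢ r t (when≢ s t (g t))) ≈⟨ Σ-delete r _ ⟩
    Σ (λ t → when≢ s t (g t)) - when≢ s r (g r)
      ≈⟨ +-cong (Σ-delete s g) (-‿cong (when≢-≢ (≢-sym r≢s))) ⟩
    Σ g - g s - g r ∎

  x≈0⇒x*y≈0 : ∀ {x y} → x ≈ 0# → x * y ≈ 0#
  x≈0⇒x*y≈0 x≈0 = trans (*-congʳ x≈0) (zeroˡ _)

  y≈0⇒x*y≈0 : ∀ {x y} → y ≈ 0# → x * y ≈ 0#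
  y≈0⇒x*y≈0 y≈0 = trans (*-congˡ y≈0) (zeroʳ _)

  Σ-delete₂-*-zeroSum : ∀ {n} {r s : Fin n} (x : Carrier) {c : Fin n → Carrier} →
    Σ c ≈ 0# → r ≢ s →
    Σ (λ t → when≢ r t (when≢ s t (x * c t))) ≈ - (x * c s) - x * c r
  Σ-delete₂-*-zeroSum x {c} Σc≈0 r≢s =
    trans (Σ-delete₂ r≢s (λ t → x * c t))
          (+-congʳ (trans (+-congʳ (trans (Σ-additive (*-additiveˡ x) c)
                                          (y≈0⇒x*y≈0 Σc≈0)))
                          (+-identityˡ _)))

  Σ² : ∀ {n} → (Fin n → Fin n → Carrier) → Carrier
  Σ² f = Σ λ i → Σ λ j → f i j

  Σ³ : ∀ {n} → (Fin n → Fin n → Fin n → Carrier) → Carrier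
  Σ³ f = Σ λ i → Σ λ j → Σ λ k → f i j k

  Σ²-cong : ∀ {n} {f g : Fin n → Fin n → Carrier} → (∀ i j → f i j ≈ g i j) →
    Σ² f ≈ Σ² g
  Σ²-cong f≈g = Σ-cong (λ i → Σ-cong (f≈g i))

  Σ³-cong : ∀ {n} {f g : Fin n → Fin n → Fin n → Carrier} →
    (∀ i j k → f i j k ≈ g i j k) → Σ³ f ≈ Σ³ g
  Σ³-cong f≈g = Σ-cong (λ i → Σ²-cong (f≈g i))

  Σ²-distrib-+ : ∀ {n} (f g : Fin n → Fin n → Carrier) →
    Σ² (λ i j → f i j + g i j) ≈ Σ² f + Σ² g
  Σ²-distrib-+ {n} f g =
    trans (Σ-cong (λ i → Σ-distrib-+ (f i) (g i))) (Σ-distrib-+ {n} _ _)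

  Σ³-distrib-+ : ∀ {n} (f g : Fin n → Fin n → Fin n → Carrier) →
    Σ³ (λ i j k → f i j k + g i j k) ≈ Σ³ f + Σ³ g
  Σ³-distrib-+ {n} f g =
    trans (Σ-cong (λ i → Σ²-distrib-+ (f i) (g i))) (Σ-distrib-+ {n} _ _)

  Σ²-additive : ∀ {n} {φ : Carrier → Carrier} → Additive φ →
    (f : Fin n → Fin n → Carrier) → Σ² (λ i j → φ (f i j)) ≈ φ (Σ² f)
  Σ²-additive {n} φ f =
    trans (Σ-cong (λ i → Σ-additive φ (f i))) (Σ-additive {n} φ _)

  Σ³-additive : ∀ {n} {φ : Carrier → Carrier} → Additive φ →
    (f : Fin n → Fin n → Fin n → Carrier) →
    Σ³ (λ i j k → φ (f i j k)) ≈ φ (Σ³ f)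
  Σ³-additive {n} φ f =
    trans (Σ-cong (λ i → Σ²-additive φ (f i))) (Σ-additive {n} φ _)

  Σ²-comm-Σ : ∀ {n} (f : Fin n → Fin n → Fin n → Carrier) →
    Σ² (λ i j → Σ (f i j)) ≈ Σ (λ r → Σ² (λ i j → f i j r))
  Σ²-comm-Σ {n} f = trans (Σ-cong (λ i → Σ-comm (f i))) (Σ-comm {n} {n} _)

  Σ³-comm-Σ : ∀ {n} (f : Fin n → Fin n → Fin n → Fin n → Carrier) →
    Σ³ (λ i j k → Σ (f i j k)) ≈ Σ (λ r → Σ³ (λ i j k → f i j k r))
  Σ³-comm-Σ {n} f = trans (Σ-cong (λ i → Σ²-comm-Σ (f i))) (Σ-comm {n} {n} _)

  Σ²-≢-* : ∀ {n} (a b : Fin n → Carrier) →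
    Σ² (λ r s → when≢ r s (a r * b s)) ≈ Σ a * Σ b - Σ (λ r → a r * b r)
  Σ²-≢-* {n} a b = begin
    Σ² (λ r s → when≢ r s (a r * b s))
      ≈⟨ Σ-cong (λ r → Σ-delete r (λ s → a r * b s)) ⟩
    Σ (λ r → Σ (λ s → a r * b s) - a r * b r)
      ≈⟨ Σ-distrib-+ {n} _ _ ⟩
    Σ (λ r → Σ (λ s → a r * b s)) + Σ (λ r → - (a r * b r))
      ≈⟨ +-cong (Σ-cong (λ r → Σ-additive (*-additiveˡ (a r)) b))
                (Σ-additive {n} -‿additive _) ⟩
    Σ (λ r → a r * Σ b) - Σ (λ r → a r * b r)
      ≈⟨ +-congʳ (Σ-additive (*-additiveʳ (Σ b)) a) ⟩
    Σ a * Σ b - Σ (λ r → a r * b r) ∎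

  Σ²-≢-*-zeroSum : ∀ {n} (a b : Fin n → Carrier) → Σ a * Σ b ≈ 0# →
    Σ² (λ r s → when≢ r s (a r * b s)) ≈ - Σ (λ r → a r * b r)
  Σ²-≢-*-zeroSum a b ΣaΣb≈0 =
    trans (Σ²-≢-* a b) (trans (+-congʳ ΣaΣb≈0) (+-identityˡ _))

  Σ³-distinct-*-zeroSum : ∀ {n} (a b c : Fin n → Carrier) →
    Σ a ≈ 0# → Σ b ≈ 0# → Σ c ≈ 0# →
    Σ³ (λ r s t → distinct3 r s t (a r * b s * c t))
      ≈ Σ (λ r → a r * b r * c r) + Σ (λ r → a r * b r * c r)
  Σ³-distinct-*-zeroSum {n} a b c Σa≈0 Σb≈0 Σc≈0 = begin
    Σ³ (λ r s t → distinct3 r s t (a r * b s * c t))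
      ≈⟨ Σ²-cong {n} (λ r s → Σ-additive {n} (when≢-additive r s) _) ⟩
    Σ² (λ r s → when≢ r s (Σ (λ t → when≢ r t (when≢ s t (a r * b s * c t)))))
      ≈⟨ Σ²-cong (λ r s → when≢-cong-≢ r s (λ r≢s →
           trans (Σ-delete₂-*-zeroSum (a r * b s) Σc≈0 r≢s) (rearrange r s))) ⟩
    Σ² (λ r s → when≢ r s (- (a r * (b s * c s)) + - (a r * c r * b s)))
      ≈⟨ trans (Σ²-cong {n} (λ r s → Additive.homo (when≢-additive r s) _ _))
               (Σ²-distrib-+ {n} _ _) ⟩
    Σ² (λ r s → when≢ r s (- (a r * (b s * c s))))
      + Σ² (λ r s → when≢ r s (- (a r * c r * b s)))
      ≈⟨ +-cong (negate (λ r s → a r * (b s * c s)))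
                (negate (λ r s → a r * c r * b s)) ⟩
    - Σ² (λ r s → when≢ r s (a r * (b s * c s)))
      + - Σ² (λ r s → when≢ r s (a r * c r * b s))
      ≈⟨ +-cong (-‿cong (Σ²-≢-*-zeroSum a (λ s → b s * c s) (x≈0⇒x*y≈0 Σa≈0)))
                (-‿cong (Σ²-≢-*-zeroSum (λ r → a r * c r) b (y≈0⇒x*y≈0 Σb≈0))) ⟩
    - - Σ (λ r → a r * (b r * c r)) + - - Σ (λ r → a r * c r * b r)
      ≈⟨ +-cong (-‿involutive _) (-‿involutive _) ⟩
    Σ (λ r → a r * (b r * c r)) + Σ (λ r → a r * c r * b r)
      ≈⟨ +-cong (Σ-cong (λ r → sym (*-assoc (a r) (b r) (c r))))
                (Σ-cong (λ r → xy∙z≈xz∙y (a r) (c r) (b r))) ⟩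
    Σ (λ r → a r * b r * c r) + Σ (λ r → a r * b r * c r) ∎
    where
    negate : (f : Fin n → Fin n → Carrier) →
      Σ² (λ r s → when≢ r s (- f r s)) ≈ - Σ² (λ r s → when≢ r s (f r s))
    negate f = trans (Σ²-cong (λ r s → when≢-neg r s (f r s)))
                     (Σ²-additive {n} -‿additive _)
    rearrange : ∀ r s → - (a r * b s * c s) - a r * b s * c r
                        ≈ - (a r * (b s * c s)) + - (a r * c r * b s)
    rearrange r s = +-cong (-‿cong (*-assoc _ _ _)) (-‿cong (xy∙z≈xz∙y _ _ _))

  trace-ᵀ· : ∀ {n} (ε : Matrix n) → tr (transpose ε · ε) ≈ sumSq ε
  trace-ᵀ· ε = Σ-comm (λ r i → ε i r * ε i r)

  pairSum≈sumSq : ∀ {n} (ε : Matrix n) → rowSumsZero ε → colSumsZero ε →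
    pairSum ε ≈ sumSq ε
  pairSum≈sumSq {n} ε rows cols = begin
    pairSum ε
      ≈⟨ Σ²-cong {n} (λ i j → Σ²-additive {n} (when≢-additive i j) _) ⟩
    Σ² (λ i j → when≢ i j (Σ² (λ r s → when≢ r s (ε i r * ε j s))))
      ≈⟨ Σ²-cong (λ i j → Additive.⟦⟧-cong (when≢-additive i j)
           (Σ²-≢-*-zeroSum (ε i) (ε j) (y≈0⇒x*y≈0 (rows j)))) ⟩
    Σ² (λ i j → when≢ i j (- Σ (λ r → ε i r * ε j r)))
      ≈⟨ Σ²-cong {n} (λ i j → trans (when≢-neg i j _)
           (-‿cong (sym (Σ-additive {n} (when≢-additive i j) _)))) ⟩
    Σ² (λ i j → - Σ (λ r → when≢ i j (ε i r * ε j r)))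
      ≈⟨ Σ²-additive {n} -‿additive _ ⟩
    - Σ² (λ i j → Σ (λ r → when≢ i j (ε i r * ε j r)))
      ≈⟨ -‿cong (Σ²-comm-Σ {n} _) ⟩
    - Σ (λ r → Σ² (λ i j → when≢ i j (ε i r * ε j r)))
      ≈⟨ -‿cong (Σ-cong (λ r → Σ²-≢-*-zeroSum (λ i → ε i r) (λ i → ε i r)
           (x≈0⇒x*y≈0 (cols r)))) ⟩
    - Σ (λ r → - Σ (λ i → ε i r * ε i r))
      ≈⟨ trans (-‿cong (Σ-additive {n} -‿additive _)) (-‿involutive _) ⟩
    Σ (λ r → Σ (λ i → ε i r * ε i r))
      ≈⟨ Σ-comm {n} {n} _ ⟩
    sumSq ε ∎

  tripleSum≈4sumCube : ∀ {n} (ε : Matrix n) → rowSumsZero ε → colSumsZero ε →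
    tripleSum ε ≈ (sumCube ε + sumCube ε) + (sumCube ε + sumCube ε)
  tripleSum≈4sumCube {n} ε rows cols = begin
    tripleSum ε
      ≈⟨ Σ³-cong {n} (λ i j k → Σ³-additive {n} (distinct3-additive i j k) _) ⟩
    Σ³ (λ i j k → distinct3 i j k
         (Σ³ (λ r s t → distinct3 r s t (ε i r * ε j s * ε k t))))
      ≈⟨ Σ³-cong (λ i j k → trans (Additive.⟦⟧-cong (distinct3-additive i j k)
           (Σ³-distinct-*-zeroSum (ε i) (ε j) (ε k) (rows i) (rows j) (rows k)))
           (Additive.homo (distinct3-additive i j k) _ _)) ⟩
    Σ³ (λ i j k → distinct3 i j k (P i j k) + distinct3 i j k (P i j k))
      ≈⟨ Σ³-distrib-+ {n} _ _ ⟩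
    T + T
      ≈⟨ +-cong T≈2sumCube T≈2sumCube ⟩
    (sumCube ε + sumCube ε) + (sumCube ε + sumCube ε) ∎
    where
    P : Fin n → Fin n → Fin n → Carrier
    P i j k = Σ (λ r → ε i r * ε j r * ε k r)
    T : Carrier
    T = Σ³ (λ i j k → distinct3 i j k (P i j k))
    T≈2sumCube : T ≈ sumCube ε + sumCube ε
    T≈2sumCube = begin
      T ≈⟨ Σ³-cong {n} (λ i j k →
             sym (Σ-additive {n} (distinct3-additive i j k) _)) ⟩
      Σ³ (λ i j k → Σ (λ r → distinct3 i j k (ε i r * ε j r * ε k r)))
        ≈⟨ Σ³-comm-Σ {n} _ ⟩
      Σ (λ r → Σ³ (λ i j k → distinct3 i j k (ε i r * ε j r * ε k r)))
        ≈⟨ Σ-cong (λ r → Σ³-distinct-*-zeroSum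
             (λ i → ε i r) (λ i → ε i r) (λ i → ε i r) (cols r) (cols r) (cols r)) ⟩
      Σ (λ r → Σ (λ i → ε i r * ε i r * ε i r) + Σ (λ i → ε i r * ε i r * ε i r))
        ≈⟨ Σ-distrib-+ {n} _ _ ⟩
      Σ (λ r → Σ (λ i → ε i r * ε i r * ε i r))
        + Σ (λ r → Σ (λ i → ε i r * ε i r * ε i r))
        ≈⟨ +-cong (Σ-comm {n} {n} _) (Σ-comm {n} {n} _) ⟩
      sumCube ε + sumCube ε ∎

  four-* : ∀ x → four * x ≈ (x + x) + (x + x)
  four-* x = begin
    ((1# + 1#) + 1# + 1#) * x        ≈⟨ distribʳ x _ _ ⟩
    ((1# + 1#) + 1#) * x + 1# * x    ≈⟨ +-congʳ (distribʳ x _ _) ⟩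
    ((1# + 1#) * x + 1# * x) + 1# * x
      ≈⟨ +-cong (+-cong (distribʳ x _ _) (*-identityˡ x)) (*-identityˡ x) ⟩
    ((1# * x + 1# * x) + x) + x
      ≈⟨ +-congʳ (+-congʳ (+-cong (*-identityˡ x) (*-identityˡ x))) ⟩
    ((x + x) + x) + x                ≈⟨ +-assoc _ _ _ ⟩
    (x + x) + (x + x) ∎

mainTheorem2 : {c ℓ : Level} (R : CommutativeRing c ℓ) → let open Sums R in
    (n : ℕ) → 3 ≤ n → (ε : Matrix n) → rowSumsZero ε → colSumsZero ε →
      (pairSum ε ≈ tr (transpose ε · ε)) × (tr (transpose ε · ε) ≈ sumSq ε)
        × (tripleSum ε ≈ four * sumCube ε)
mainTheorem2 R n _ ε rows cols =
  trans (pairSum≈sumSq ε rows cols) (sym (trace-ᵀ· ε)) ,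
  trace-ᵀ· ε ,
  trans (tripleSum≈4sumCube ε rows cols) (sym (four-* _))
  where
  open CommutativeRing R using (sym; trans)
  open DistinctIndexSums R using (pairSum≈sumSq; trace-ᵀ·; tripleSum≈4sumCube; four-*)
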